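{- Let $n \in \mathbb{N}$. Then $C_{2n}$ has at least $\frac{2^{n-1}}{n}$ pairwise non-isomorphic induced sub-tournaments on $n$ vertices.
   Context: For $N \in \mathbb{N}$, the cyclic tournament $C_N$ has vertex set $\{x_1,\ldots,x_N\}$, with $x_i \to x_j$ if and only if $1 \le (j - i \bmod N) < N/2$, or $j - i = N/2$. -}

module Defs where

open import Data.Nat using (ℕ; suc; _+_; _*_; _≤_; _<_; _^_; _∸_)
open import Data.Nat.DivMod using (_%_)
open import Data.Fin using (Fin; toℕ)
open import Data.Fin.Permutation using (Permutation′; _⟨$⟩ʳ_)
open import Data.Sum using (_⊎_)
open import Data.Product using (_×_; Σ)
open import Function.Bundles using (_⇔_)
open import Function.Definitions using (Injective)
open import Relation.Binary.PropositionalEquality using (_≡_)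

Digraph : ℕ → Set₁
Digraph n = Fin n → Fin n → Set

-- The cyclic tournament C_N on vertices x_0,…,x_{N-1} (0-indexed; the paper's
-- x_{i+1} is our vertex i, which does not affect differences of indices).
-- x_i → x_j iff 1 ≤ (j - i mod N) < N/2, or j - i = N/2 (as integers).
-- "d < N/2" is written 2*d < N; "j - i = N/2" is written 2*j ≡ 2*i + N.
C : (N : ℕ) → Digraph N
C 0 i j = Data.Fin.Fin 0
C (suc m) i j =
  let N = suc m
      d = (toℕ j + N ∸ toℕ i) % N
  in (1 ≤ d × 2 * d < N) ⊎ (2 * toℕ j ≡ 2 * toℕ i + N)

Induced : ∀ {N k} → Digraph N → (Fin k → Fin N) → Digraph k
Induced T f a b = T (f a) (f b)

_≅_ : ∀ {n} → Digraph n → Digraph n → Set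
_≅_ {n} T U = Σ (Permutation′ n) λ σ → ∀ a b → T a b ⇔ U (σ ⟨$⟩ʳ a) (σ ⟨$⟩ʳ b)

-- Choose one vertex from each antipodal pair {x_u, x_{u+n}} of C_{2n}: each of the 2^n
-- choices induces a tournament on n vertices. An isomorphism between two of them extends,
-- by sending antipodes to antipodes, to an automorphism of C_{2n} with its antipodal arcs
-- deleted. There the successor of a vertex is the out-neighbour that beats all its other
-- out-neighbours, so the automorphism commutes with the successor and is a rotation. Hence
-- an isomorphism class contains at most 2n of the 2^n choices, and greedily chosen
-- representatives give at least 2^n / 2n classes.
module Submission where

open import Algebra.Bundles using (CommutativeRing; CommutativeMonoid)
open import Data.Bool using (Bool; true; false; not; _xor_)
import Data.Bool.Properties as Boolₚ
open import Data.Empty using (⊥-elim)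
open import Data.Fin as Fin
  using (Fin; zero; suc; toℕ; fromℕ; inject₁; _↑ˡ_; _↑ʳ_; combine; funToFin; finToFun)
open import Data.Fin.Induction using (<-weakInduction)
open import Data.Fin.Permutation using (Permutation′; _⟨$⟩ʳ_; _⟨$⟩ˡ_; inverseʳ; flip)
import Data.Fin.Properties as Finₚ
open import Data.Fin.Relation.Unary.Top as Top using (‵fromℕ; ‵inject₁)
open import Data.List as List using (List; []; _∷_; allFin)
open import Data.List.Membership.Propositional using (_∈_)
open import Data.List.Membership.Propositional.Properties using (∈-lookup; ∈-map⁺; ∈-allFin)
import Data.List.Relation.Unary.All as All
open import Data.List.Relation.Unary.All.Properties.Core using (¬Any⇒All¬)
open import Data.List.Relation.Unary.AllPairs using (AllPairs; []; _∷_)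
open import Data.List.Relation.Unary.Any as Any using (Any; here; there)
open import Data.List.Relation.Unary.Any.Properties using (lookup-index)
open import Data.Nat as ℕ using (ℕ; _+_; _*_; _^_; _∸_; _≤_; _<_; z≤n; s≤s; NonZero)
open import Data.Nat.DivMod using (_%_; [m+n]%n≡m%n; m<n⇒m%n≡m)
open import Data.Nat.GeneralisedArithmetic using (fold; fold-+)
import Data.Nat.Properties as ℕₚ
open import Data.Nat.Tactic.RingSolver using (solve-∀)
open import Data.Product using (Σ; _×_; _,_; proj₁; proj₂)
open import Data.Product.Properties using (≡-dec)
open import Data.Sum using (_⊎_; inj₁; inj₂)
open import Function.Base using (_∘_)
open import Function.Bundles using (_⇔_; mk⇔; Equivalence; Inverse)
open import Function.Definitions using (Injective)
import Function.Properties.Equivalence as ⇔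
open import Level using (0ℓ)
open import Relation.Binary.Core using (Rel)
open import Relation.Binary.Definitions
  using (Asymmetric; Decidable; DecidableEquality; Reflexive; Symmetric; tri<; tri≈; tri>)
open import Relation.Binary.PropositionalEquality
  using (_≡_; _≢_; _≗_; refl; sym; trans; cong; cong₂; subst; subst₂; module ≡-Reasoning)
import Relation.Binary.Reasoning.Setoid as SetoidReasoning
open import Relation.Nullary using (¬_; Dec; yes; no; does)
open import Relation.Nullary.Decidable using (dec-true; dec-false)

open import Algebra.Properties.CommutativeSemigroup
  (CommutativeMonoid.commutativeSemigroup (CommutativeRing.+-commutativeMonoid Boolₚ.xor-∧-commutativeRing))
  using (interchange)

open import Defs

module ⇔-Reasoning = SetoidReasoning (⇔.⇔-setoid 0ℓ)

funToFin-cong : ∀ {m n} {f g : Fin m → Fin n} → f ≗ g → funToFin f ≡ funToFin g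
funToFin-cong {ℕ.zero}  eq = refl
funToFin-cong {ℕ.suc m} eq = cong₂ combine (eq zero) (funToFin-cong (eq ∘ suc))

finToFun-injective : ∀ {m n} {i j : Fin (n ^ m)} → finToFun {n} {m} i ≗ finToFun j → i ≡ j
finToFun-injective {m} {n} {i} {j} eq = begin
  i                              ≡⟨ Finₚ.funToFin-finToFin {m} {n} i ⟨
  funToFin (finToFun {n} {m} i)  ≡⟨ funToFin-cong eq ⟩
  funToFin (finToFun {n} {m} j)  ≡⟨ Finₚ.funToFin-finToFin {m} {n} j ⟩
  j                              ∎
  where open ≡-Reasoning

xor-cancelˡ : ∀ e c → e xor (e xor c) ≡ c
xor-cancelˡ false c = refl
xor-cancelˡ true  c = Boolₚ.not-involutive c

2*m≡m+m : ∀ m → 2 * m ≡ m + m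
2*m≡m+m m = cong (m +_) (ℕₚ.+-identityʳ m)

2*m<n+n⇔m<n : ∀ m n → 2 * m < n + n ⇔ m < n
2*m<n+n⇔m<n m n = mk⇔
  (λ 2m<2n → ℕₚ.*-cancelˡ-< 2 m n (subst (2 * m <_) (sym (2*m≡m+m n)) 2m<2n))
  (λ m<n → subst (_< n + n) (sym (2*m≡m+m m)) (ℕₚ.+-mono-< m<n m<n))

2*m≡2*n+[o+o]⇒m≡n+o : ∀ m n o → 2 * m ≡ 2 * n + (o + o) → m ≡ n + o
2*m≡2*n+[o+o]⇒m≡n+o m n o 2m≡2n+2o = ℕₚ.*-cancelˡ-≡ m (n + o) 2 (begin
  2 * m            ≡⟨ 2m≡2n+2o ⟩
  2 * n + (o + o)  ≡⟨ cong (2 * n +_) (2*m≡m+m o) ⟨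
  2 * n + 2 * o    ≡⟨ ℕₚ.*-distribˡ-+ 2 n o ⟨
  2 * (n + o)      ∎)
  where open ≡-Reasoning

module _ {o : ℕ} .{{_ : NonZero o}} where

  m≤n⇒[n+o∸m]%o≡n∸m : ∀ {m n} → m ≤ n → n < o → (n + o ∸ m) % o ≡ n ∸ m
  m≤n⇒[n+o∸m]%o≡n∸m {m} {n} m≤n n<o = begin
    (n + o ∸ m) % o  ≡⟨ cong (_% o) (ℕₚ.+-∸-comm o m≤n) ⟩
    (n ∸ m + o) % o  ≡⟨ [m+n]%n≡m%n (n ∸ m) o ⟩
    (n ∸ m) % o      ≡⟨ m<n⇒m%n≡m (ℕₚ.≤-<-trans (ℕₚ.m∸n≤m n m) n<o) ⟩
    n ∸ m            ∎
    where open ≡-Reasoning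

  n<m⇒[n+o∸m]%o≡n+o∸m : ∀ {m n} → n < m → (n + o ∸ m) % o ≡ n + o ∸ m
  n<m⇒[n+o∸m]%o≡n+o∸m {m} {n} n<m = m<n⇒m%n≡m (ℕₚ.m<n+o⇒m∸n<o (n + o) m (ℕₚ.+-monoˡ-< o n<m))

≅-sym : ∀ {n} {T U : Digraph n} → T ≅ U → U ≅ T
≅-sym {T = T} {U} (σ , σ-iso) = flip σ , λ a b →
  subst₂ (λ x y → U x y ⇔ T (σ ⟨$⟩ˡ a) (σ ⟨$⟩ˡ b)) (inverseʳ σ) (inverseʳ σ)
    (⇔.sym (σ-iso (σ ⟨$⟩ˡ a) (σ ⟨$⟩ˡ b)))

AllPairs-lookup : ∀ {A : Set} {R : Rel A 0ℓ} {xs : List A} → AllPairs R xs →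
                  ∀ {i j} → i Fin.< j → R (List.lookup xs i) (List.lookup xs j)
AllPairs-lookup (Rx ∷ _)   {zero}  {suc j} _   = All.lookup Rx (∈-lookup j)
AllPairs-lookup (_  ∷ Rxs) {suc i} {suc j} i<j = AllPairs-lookup Rxs (ℕ.s<s⁻¹ i<j)

module Representatives {A : Set} {R : Rel A 0ℓ} (R? : Decidable R) (R-refl : Reflexive R) where

  greedy : List A → List A → List A
  greedy chosen [] = chosen
  greedy chosen (x ∷ xs) with Any.any? (λ a → R? a x) chosen
  ... | yes _ = greedy chosen xs
  ... | no _  = greedy (x ∷ chosen) xs

  greedy-unrelated : ∀ chosen xs → AllPairs (λ a b → ¬ R b a) chosen →
                     AllPairs (λ a b → ¬ R b a) (greedy chosen xs)
  greedy-unrelated chosen [] p = p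
  greedy-unrelated chosen (x ∷ xs) p with Any.any? (λ a → R? a x) chosen
  ... | yes _       = greedy-unrelated chosen xs p
  ... | no ¬reached = greedy-unrelated (x ∷ chosen) xs (¬Any⇒All¬ chosen ¬reached ∷ p)

  greedy-keeps : ∀ {P : A → Set} chosen xs → Any P chosen → Any P (greedy chosen xs)
  greedy-keeps chosen [] p = p
  greedy-keeps chosen (x ∷ xs) p with Any.any? (λ a → R? a x) chosen
  ... | yes _ = greedy-keeps chosen xs p
  ... | no _  = greedy-keeps (x ∷ chosen) xs (there p)

  greedy-covers : ∀ chosen {xs y} → y ∈ xs → Any (λ a → R a y) (greedy chosen xs)
  greedy-covers chosen {x ∷ xs} (here refl) with Any.any? (λ a → R? a x) chosen
  ... | yes reached = greedy-keeps chosen xs reached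
  ... | no _        = greedy-keeps (x ∷ chosen) xs (here R-refl)
  greedy-covers chosen {x ∷ xs} (there y∈xs) with Any.any? (λ a → R? a x) chosen
  ... | yes _ = greedy-covers chosen y∈xs
  ... | no _  = greedy-covers (x ∷ chosen) y∈xs

  representatives : List A → List A
  representatives = greedy []

  representatives-unrelated : ∀ xs → AllPairs (λ a b → ¬ R b a) (representatives xs)
  representatives-unrelated xs = greedy-unrelated [] xs []

  representatives-cover : ∀ {xs y} → y ∈ xs → Any (λ a → R a y) (representatives xs)
  representatives-cover = greedy-covers []

  representatives-distinct : ∀ {S : Rel A 0ℓ} → Symmetric S → (∀ {a b} → S a b → R a b) →
    ∀ xs {i j} → i ≢ j → ¬ S (List.lookup (representatives xs) i) (List.lookup (representatives xs) j)
  representatives-distinct S-sym S⇒R xs {i} {j} i≢j Sij with Finₚ.<-cmp i j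
  ... | tri< i<j _ _ = AllPairs-lookup (representatives-unrelated xs) i<j (S⇒R (S-sym Sij))
  ... | tri≈ _ i≡j _ = i≢j i≡j
  ... | tri> _ _ j<i = AllPairs-lookup (representatives-unrelated xs) j<i (S⇒R Sij)

module _ {X : Set} (_≟_ : DecidableEquality X) {_⇒_ : Rel X 0ℓ} (⇒-asym : Asymmetric _⇒_)
         {next : X → X} (⇒-next : ∀ x → x ⇒ next x)
         (next-⇒ : ∀ {x w} → x ⇒ w → w ≢ next x → next x ⇒ w) where

  automorphism-commutes-with-next : {g g⁻¹ : X → X} → (∀ y → g (g⁻¹ y) ≡ y) →
    (∀ x y → x ⇒ y ⇔ g x ⇒ g y) → ∀ x → g (next x) ≡ next (g x)
  automorphism-commutes-with-next {g} {g⁻¹} g∘g⁻¹ g-auto x with g (next x) ≟ next (g x)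
  ... | yes eq = eq
  ... | no neq = ⊥-elim (⇒-asym (subst (g (next x) ⇒_) (g∘g⁻¹ _) gnext⇒gw) (next-⇒ gx⇒gnext neq))
    where
      open Equivalence
      w = g⁻¹ (next (g x))
      x⇒w : x ⇒ w
      x⇒w = from (g-auto x w) (subst (g x ⇒_) (sym (g∘g⁻¹ _)) (⇒-next (g x)))
      w≢next : w ≢ next x
      w≢next w≡next = neq (trans (cong g (sym w≡next)) (g∘g⁻¹ _))
      gnext⇒gw : g (next x) ⇒ g w
      gnext⇒gw = to (g-auto (next x) w) (next-⇒ x⇒w w≢next)
      gx⇒gnext : g x ⇒ g (next x)
      gx⇒gnext = to (g-auto x (next x)) (⇒-next x)

module _ {X : Set} (next : X → X) where

  fold-comm : ∀ x j k → fold (fold x next j) next k ≡ fold (fold x next k) next j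
  fold-comm x j k = begin
    fold (fold x next j) next k  ≡⟨ fold-+ x next k ⟨
    fold x next (k + j)          ≡⟨ cong (fold x next) (ℕₚ.+-comm k j) ⟩
    fold x next (j + k)          ≡⟨ fold-+ x next j ⟩
    fold (fold x next k) next j  ∎
    where open ≡-Reasoning

  commutes-with-fold : {g : X → X} → (∀ x → g (next x) ≡ next (g x)) →
                       ∀ k x → g (fold x next k) ≡ fold (g x) next k
  commutes-with-fold g∘next ℕ.zero    x = refl
  commutes-with-fold g∘next (ℕ.suc k) x =
    trans (g∘next (fold x next k)) (cong next (commutes-with-fold g∘next k x))

  commuting⇒fold : ∀ {K} base → (∀ x → Σ (Fin K) λ j → fold base next (toℕ j) ≡ x) →
                   {g : X → X} → (∀ x → g (next x) ≡ next (g x)) →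
                   Σ (Fin K) λ r → ∀ x → g x ≡ fold x next (toℕ r)
  commuting⇒fold base reach {g} g∘next = r , λ x → let (j , base→x) = reach x in begin
    g x                                         ≡⟨ cong g base→x ⟨
    g (fold base next (toℕ j))                  ≡⟨ commutes-with-fold g∘next (toℕ j) base ⟩
    fold (g base) next (toℕ j)                  ≡⟨ cong (λ y → fold y next (toℕ j)) base→gbase ⟨
    fold (fold base next (toℕ r)) next (toℕ j)  ≡⟨ fold-comm base (toℕ r) (toℕ j) ⟩
    fold (fold base next (toℕ j)) next (toℕ r)  ≡⟨ cong (λ y → fold y next (toℕ r)) base→x ⟩
    fold x next (toℕ r)                         ∎
    where
      open ≡-Reasoning
      r = proj₁ (reach (g base))
      base→gbase = proj₂ (reach (g base))

-- The point (u , false) is the vertex x_u of C_{2n} and (u , true) its antipode x_{u+n};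
-- _⇒_ is C_{2n} with the arcs between antipodes deleted, and next is the rotation x_i ↦ x_{i+1}.
module Circle (k : ℕ) where

  -- For n = 1 the successor of a point is its antipode, so ⇒-next needs n ≥ 2.
  n : ℕ
  n = ℕ.suc (ℕ.suc k)

  Point : Set
  Point = Fin n × Bool

  _≟ₚ_ : DecidableEquality Point
  _≟ₚ_ = ≡-dec Finₚ._≟_ Boolₚ._≟_

  _<[_]_ : Fin n → Bool → Fin n → Set
  u <[ false ] v = u Fin.< v
  u <[ true  ] v = v Fin.< u

  _⇒_ : Point → Point → Set
  (u , c) ⇒ (v , d) = u <[ c xor d ] v

  next : Point → Point
  next (u , c) with Top.view u
  ... | ‵fromℕ     = zero , not c
  ... | ‵inject₁ j = suc j , c

  ⇒-asym : ∀ {x y} → x ⇒ y → ¬ (y ⇒ x)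
  ⇒-asym {_ , false} {_ , false} = ℕₚ.<-asym
  ⇒-asym {_ , false} {_ , true}  = ℕₚ.<-asym
  ⇒-asym {_ , true}  {_ , false} = ℕₚ.<-asym
  ⇒-asym {_ , true}  {_ , true}  = ℕₚ.<-asym

  inject₁<suc : (j : Fin (ℕ.suc k)) → inject₁ j Fin.< suc j
  inject₁<suc j = Finₚ.≤̄⇒inject₁< ℕₚ.≤-refl

  ⇒-next : ∀ x → x ⇒ next x
  ⇒-next (u , c) with Top.view u
  ⇒-next (_ , false) | ‵fromℕ     = s≤s z≤n
  ⇒-next (_ , true)  | ‵fromℕ     = s≤s z≤n
  ⇒-next (_ , false) | ‵inject₁ j = inject₁<suc j
  ⇒-next (_ , true)  | ‵inject₁ j = inject₁<suc j

  ≢zero⇒0< : {v : Fin n} → v ≢ zero → 0 < toℕ v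
  ≢zero⇒0< v≢0 = ℕₚ.n≢0⇒n>0 (v≢0 ∘ Finₚ.toℕ-injective)

  inject₁<∧≢suc⇒suc< : ∀ {j : Fin (ℕ.suc k)} {v} → inject₁ j Fin.< v → v ≢ suc j → suc j Fin.< v
  inject₁<∧≢suc⇒suc< {j} j<v v≢1+j =
    Finₚ.≤∧≢⇒< (subst (_< _) (Finₚ.toℕ-inject₁ j) j<v) (v≢1+j ∘ sym)

  next-⇒ : ∀ {x w} → x ⇒ w → w ≢ next x → next x ⇒ w
  next-⇒ {u , c} {v , d} x⇒w w≢next with Top.view u
  next-⇒ {_ , false} {v , false} x⇒w _      | ‵fromℕ     = ⊥-elim (ℕₚ.<⇒≱ x⇒w (Finₚ.≤fromℕ v))
  next-⇒ {_ , true}  {v , true}  x⇒w _      | ‵fromℕ     = ⊥-elim (ℕₚ.<⇒≱ x⇒w (Finₚ.≤fromℕ v))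
  next-⇒ {_ , false} {v , true}  _   w≢next | ‵fromℕ     = ≢zero⇒0< (w≢next ∘ cong (_, true))
  next-⇒ {_ , true}  {v , false} _   w≢next | ‵fromℕ     = ≢zero⇒0< (w≢next ∘ cong (_, false))
  next-⇒ {_ , false} {v , false} x⇒w w≢next | ‵inject₁ j = inject₁<∧≢suc⇒suc< x⇒w (w≢next ∘ cong (_, false))
  next-⇒ {_ , true}  {v , true}  x⇒w w≢next | ‵inject₁ j = inject₁<∧≢suc⇒suc< x⇒w (w≢next ∘ cong (_, true))
  next-⇒ {_ , false} {v , true}  x⇒w _      | ‵inject₁ j = Finₚ.<-trans x⇒w (inject₁<suc j)
  next-⇒ {_ , true}  {v , false} x⇒w _      | ‵inject₁ j = Finₚ.<-trans x⇒w (inject₁<suc j)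

  next-inject₁ : ∀ j c → next (inject₁ j , c) ≡ (suc j , c)
  next-inject₁ j c rewrite Top.view-inject₁ j = refl

  next-fromℕ : ∀ c → next (fromℕ (ℕ.suc k) , c) ≡ (zero , not c)
  next-fromℕ c rewrite Top.view-fromℕ (ℕ.suc k) = refl

  fold-next-zero : ∀ c u → fold (zero , c) next (toℕ u) ≡ (u , c)
  fold-next-zero c = <-weakInduction (λ u → fold (zero , c) next (toℕ u) ≡ (u , c)) refl step
    where
      step : ∀ j → fold (zero , c) next (toℕ (inject₁ j)) ≡ (inject₁ j , c) →
             fold (zero , c) next (ℕ.suc (toℕ j)) ≡ (suc j , c)
      step j hyp = begin
        next (fold (zero , c) next (toℕ j))            ≡⟨ cong (next ∘ fold (zero , c) next) (Finₚ.toℕ-inject₁ j) ⟨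
        next (fold (zero , c) next (toℕ (inject₁ j)))  ≡⟨ cong next hyp ⟩
        next (inject₁ j , c)                           ≡⟨ next-inject₁ j c ⟩
        (suc j , c)                                    ∎
        where open ≡-Reasoning

  half-turn : ∀ c → fold (zero , c) next n ≡ (zero , not c)
  half-turn c = begin
    next (fold (zero , c) next (ℕ.suc k))                ≡⟨ cong (next ∘ fold (zero , c) next) (Finₚ.toℕ-fromℕ (ℕ.suc k)) ⟨
    next (fold (zero , c) next (toℕ (fromℕ (ℕ.suc k))))  ≡⟨ cong next (fold-next-zero c (fromℕ (ℕ.suc k))) ⟩
    next (fromℕ (ℕ.suc k) , c)                           ≡⟨ next-fromℕ c ⟩
    (zero , not c)                                       ∎
    where open ≡-Reasoning

  origin : Point
  origin = zero , false

  reach : ∀ x → Σ (Fin (n + n)) λ j → fold origin next (toℕ j) ≡ x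
  reach (u , false) = u ↑ˡ n , (begin
    fold origin next (toℕ (u ↑ˡ n))  ≡⟨ cong (fold origin next) (Finₚ.toℕ-↑ˡ u n) ⟩
    fold origin next (toℕ u)         ≡⟨ fold-next-zero false u ⟩
    (u , false)                      ∎)
    where open ≡-Reasoning
  reach (u , true) = n ↑ʳ u , (begin
    fold origin next (toℕ (n ↑ʳ u))         ≡⟨ cong (fold origin next) (Finₚ.toℕ-↑ʳ n u) ⟩
    fold origin next (n + toℕ u)            ≡⟨ fold-+ origin next n ⟩
    fold (fold origin next (toℕ u)) next n  ≡⟨ fold-comm next origin (toℕ u) n ⟩
    fold (fold origin next n) next (toℕ u)  ≡⟨ cong (λ x → fold x next (toℕ u)) (half-turn false) ⟩
    fold (zero , true) next (toℕ u)         ≡⟨ fold-next-zero true u ⟩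
    (u , true)                              ∎)
    where open ≡-Reasoning

  -- The first disjunct of C (n + n); the second one never relates two non-antipodal vertices.
  CArc : ℕ → ℕ → Set
  CArc x y = 1 ≤ d × 2 * d < n + n
    where d = (y + (n + n) ∸ x) % (n + n)

  -- y lies between 1 and n - 1 steps after x around ℤ/2n.
  Ahead : ℕ → ℕ → Set
  Ahead x y = (x < y × y < x + n) ⊎ (y + n < x)

  CArc⇔Ahead : ∀ {x y} → x < n + n → y < n + n → CArc x y ⇔ Ahead x y
  CArc⇔Ahead {x} {y} x<2n y<2n with x ℕₚ.≤? y
  ... | yes x≤y = mk⇔ to from
    where
      open Equivalence (2*m<n+n⇔m<n (y ∸ x) n) renaming (to to <n; from to <2n)
      to : CArc x y → Ahead x y
      to (1≤d , 2d<2n) rewrite m≤n⇒[n+o∸m]%o≡n∸m x≤y y<2n =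
        inj₁ (ℕₚ.m∸n≢0⇒n<m (ℕₚ.>⇒≢ 1≤d) ,
              subst (_< x + n) (ℕₚ.m+[n∸m]≡n x≤y) (ℕₚ.+-monoʳ-< x (<n 2d<2n)))
      from : Ahead x y → CArc x y
      from (inj₁ (x<y , y<x+n)) rewrite m≤n⇒[n+o∸m]%o≡n∸m x≤y y<2n =
        ℕₚ.m<n⇒0<n∸m x<y , <2n (ℕₚ.m<n+o⇒m∸n<o y x y<x+n)
      from (inj₂ y+n<x) = ⊥-elim (ℕₚ.<⇒≱ y+n<x (ℕₚ.≤-trans x≤y (ℕₚ.m≤m+n y n)))
  ... | no x≰y = mk⇔ to from
    where
      y<x = ℕₚ.≰⇒> x≰y
      open Equivalence (2*m<n+n⇔m<n (y + (n + n) ∸ x) n) renaming (to to <n; from to <2n)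
      y+n+n≡x+d : (y + n) + n ≡ x + (y + (n + n) ∸ x)
      y+n+n≡x+d = trans (ℕₚ.+-assoc y n n)
        (sym (ℕₚ.m+[n∸m]≡n (ℕₚ.≤-trans (ℕₚ.<⇒≤ x<2n) (ℕₚ.m≤n+m (n + n) y))))
      to : CArc x y → Ahead x y
      to (_ , 2d<2n) rewrite n<m⇒[n+o∸m]%o≡n+o∸m {n + n} y<x = inj₂ (ℕₚ.+-cancelʳ-< n (y + n) x
        (subst (_< x + n) (sym y+n+n≡x+d) (ℕₚ.+-monoʳ-< x (<n 2d<2n))))
      from : Ahead x y → CArc x y
      from (inj₁ (x<y , _)) = ⊥-elim (ℕₚ.<-asym x<y y<x)
      from (inj₂ y+n<x) rewrite n<m⇒[n+o∸m]%o≡n+o∸m {n + n} y<x =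
        ℕₚ.m<n⇒0<n∸m (ℕₚ.<-≤-trans x<2n (ℕₚ.m≤n+m (n + n) y)) ,
        <2n (ℕₚ.m<n+o⇒m∸n<o (y + (n + n)) x (subst (_< x + n) (ℕₚ.+-assoc y n n) (ℕₚ.+-monoˡ-< n y+n<x)))

  offset : Bool → ℕ
  offset false = 0
  offset true  = n

  position : Point → ℕ
  position (u , c) = offset c + toℕ u

  toℕ<n+ : ∀ (u : Fin n) m → toℕ u < n + m
  toℕ<n+ u m = ℕₚ.<-≤-trans (Finₚ.toℕ<n u) (ℕₚ.m≤m+n n m)

  toℕ<+n : ∀ (u : Fin n) m → toℕ u < m + n
  toℕ<+n u m = ℕₚ.<-≤-trans (Finₚ.toℕ<n u) (ℕₚ.m≤n+m n m)

  n+toℕ<n+m+n : ∀ (u : Fin n) m → n + toℕ u < (n + m) + n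
  n+toℕ<n+m+n u m = ℕₚ.<-≤-trans (ℕₚ.+-monoʳ-< n (Finₚ.toℕ<n u)) (ℕₚ.+-monoˡ-≤ n (ℕₚ.m≤m+n n m))

  Ahead⇔⇒ : ∀ x y → Ahead (position x) (position y) ⇔ x ⇒ y
  Ahead⇔⇒ (u , false) (v , false) = mk⇔ to from
    where
      to : Ahead (toℕ u) (toℕ v) → toℕ u < toℕ v
      to (inj₁ (u<v , _)) = u<v
      to (inj₂ v+n<u)     = ⊥-elim (ℕₚ.<-asym v+n<u (toℕ<+n u (toℕ v)))
      from : toℕ u < toℕ v → Ahead (toℕ u) (toℕ v)
      from u<v = inj₁ (u<v , toℕ<+n v (toℕ u))
  Ahead⇔⇒ (u , true) (v , true) = mk⇔ to from
    where
      to : Ahead (n + toℕ u) (n + toℕ v) → toℕ u < toℕ v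
      to (inj₁ (u<v , _)) = ℕₚ.+-cancelˡ-< n (toℕ u) (toℕ v) u<v
      to (inj₂ v+n<u)     = ⊥-elim (ℕₚ.<-asym v+n<u (n+toℕ<n+m+n u (toℕ v)))
      from : toℕ u < toℕ v → Ahead (n + toℕ u) (n + toℕ v)
      from u<v = inj₁ (ℕₚ.+-monoʳ-< n u<v , n+toℕ<n+m+n v (toℕ u))
  Ahead⇔⇒ (u , false) (v , true) = mk⇔ to from
    where
      to : Ahead (toℕ u) (n + toℕ v) → toℕ v < toℕ u
      to (inj₁ (_ , v<u)) = ℕₚ.+-cancelˡ-< n (toℕ v) (toℕ u) (subst (n + toℕ v <_) (ℕₚ.+-comm (toℕ u) n) v<u)
      to (inj₂ v+n<u)     = ⊥-elim (ℕₚ.<-asym v+n<u (toℕ<+n u (n + toℕ v)))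
      from : toℕ v < toℕ u → Ahead (toℕ u) (n + toℕ v)
      from v<u = inj₁ (toℕ<n+ u (toℕ v) , subst (n + toℕ v <_) (ℕₚ.+-comm n (toℕ u)) (ℕₚ.+-monoʳ-< n v<u))
  Ahead⇔⇒ (u , true) (v , false) = mk⇔ to from
    where
      to : Ahead (n + toℕ u) (toℕ v) → toℕ v < toℕ u
      to (inj₁ (u<v , _)) = ⊥-elim (ℕₚ.<-asym u<v (toℕ<n+ v (toℕ u)))
      to (inj₂ v+n<u)     = ℕₚ.+-cancelʳ-< n (toℕ v) (toℕ u) (subst (toℕ v + n <_) (ℕₚ.+-comm n (toℕ u)) v+n<u)
      from : toℕ v < toℕ u → Ahead (n + toℕ u) (toℕ v)
      from v<u = inj₂ (subst (toℕ v + n <_) (ℕₚ.+-comm (toℕ u) n) (ℕₚ.+-monoˡ-< n v<u))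

  vertex : Point → Fin (n + n)
  vertex (u , false) = u ↑ˡ n
  vertex (u , true)  = n ↑ʳ u

  toℕ-vertex : ∀ x → toℕ (vertex x) ≡ position x
  toℕ-vertex (u , false) = Finₚ.toℕ-↑ˡ u n
  toℕ-vertex (u , true)  = Finₚ.toℕ-↑ʳ n u

  position<n+n : ∀ x → position x < n + n
  position<n+n x = subst (_< n + n) (toℕ-vertex x) (Finₚ.toℕ<n (vertex x))

  vertex-injective : ∀ {x y} → vertex x ≡ vertex y → x ≡ y
  vertex-injective {u , false} {v , false} eq = cong (_, false) (Finₚ.↑ˡ-injective n u v eq)
  vertex-injective {u , true}  {v , true}  eq = cong (_, true) (Finₚ.↑ʳ-injective n u v eq)
  vertex-injective {u , false} {v , true}  eq = ⊥-elim (ℕₚ.<⇒≢ (toℕ<n+ u (toℕ v))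
    (trans (sym (toℕ-vertex (u , false))) (trans (cong toℕ eq) (toℕ-vertex (v , true)))))
  vertex-injective {u , true}  {v , false} eq = sym (vertex-injective (sym eq))

  NonAntipodal : Point → Point → Set
  NonAntipodal (u , c) (v , d) = u ≡ v → c ≡ d

  position≢antipode : ∀ x y → NonAntipodal x y → position y ≢ position x + n
  position≢antipode (u , c)     (v , false) _ v≡u+n = ℕₚ.<⇒≢ (toℕ<+n v (offset c + toℕ u)) v≡u+n
  position≢antipode (u , false) (v , true)  u≡v⇒ v≡u+n
    with () ← u≡v⇒ (Finₚ.toℕ-injective (sym (ℕₚ.+-cancelˡ-≡ n (toℕ v) (toℕ u)
                      (trans v≡u+n (ℕₚ.+-comm (toℕ u) n)))))
  position≢antipode (u , true)  (v , true)  _ v≡u+n = ℕₚ.<⇒≢ (toℕ<+n v (toℕ u))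
    (ℕₚ.+-cancelˡ-≡ n (toℕ v) (toℕ u + n) (trans v≡u+n (ℕₚ.+-assoc n (toℕ u) n)))

  vertex-arc : ∀ x y → NonAntipodal x y → C (n + n) (vertex x) (vertex y) ⇔ x ⇒ y
  vertex-arc x y x≁y = mk⇔ to from
    where
      arc⇔ : CArc (position x) (position y) ⇔ x ⇒ y
      arc⇔ = ⇔.trans (CArc⇔Ahead (position<n+n x) (position<n+n y)) (Ahead⇔⇒ x y)
      to : C (n + n) (vertex x) (vertex y) → x ⇒ y
      to (inj₁ arc) = Equivalence.to arc⇔ (subst₂ CArc (toℕ-vertex x) (toℕ-vertex y) arc)
      to (inj₂ tie) = ⊥-elim (position≢antipode x y x≁y (2*m≡2*n+[o+o]⇒m≡n+o (position y) (position x) n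
        (subst₂ (λ a b → 2 * b ≡ 2 * a + (n + n)) (toℕ-vertex x) (toℕ-vertex y) tie)))
      from : x ⇒ y → C (n + n) (vertex x) (vertex y)
      from x⇒y = inj₁ (subst₂ CArc (sym (toℕ-vertex x)) (sym (toℕ-vertex y)) (Equivalence.from arc⇔ x⇒y))

  Signs : Set
  Signs = Fin n → Bool

  select : Signs → Fin n → Fin (n + n)
  select ε u = vertex (u , ε u)

  select-injective : ∀ ε → Injective _≡_ _≡_ (select ε)
  select-injective ε {u} {v} eq = cong proj₁ (vertex-injective {u , ε u} {v , ε v} eq)

  select-arc : ∀ ε u v → Induced (C (n + n)) (select ε) u v ⇔ (u , ε u) ⇒ (v , ε v)
  select-arc ε u v = vertex-arc (u , ε u) (v , ε v) (cong ε)

  _≅ₛ_ : Rel Signs 0ℓ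
  ε ≅ₛ δ = Induced (C (n + n)) (select ε) ≅ Induced (C (n + n)) (select δ)

  _⇒[_]_ : Point → Bool → Point → Set
  x ⇒[ false ] y = x ⇒ y
  x ⇒[ true  ] y = y ⇒ x

  ⇒-xor : ∀ u c v d s t → (u , c xor s) ⇒ (v , d xor t) ⇔ (u , c) ⇒[ s xor t ] (v , d)
  ⇒-xor u c v d s t = subst (λ b → u <[ b ] v ⇔ (u , c) ⇒[ s xor t ] (v , d))
                            (sym (interchange c s d t)) (shift (s xor t))
    where
      shift : ∀ b → u <[ (c xor d) xor b ] v ⇔ (u , c) ⇒[ b ] (v , d)
      shift false rewrite Boolₚ.xor-identityʳ (c xor d) = ⇔.refl
      shift true  rewrite Boolₚ.xor-comm d c = flip-side (c xor d)
        where
          flip-side : ∀ b → u <[ b xor true ] v ⇔ v <[ b ] u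
          flip-side false = ⇔.refl
          flip-side true  = ⇔.refl

  -- lift extends σ to all points, sending the antipode of a selected vertex to the antipode of its image.
  module Lift (ε δ : Signs) (σ : Permutation′ n)
              (σ-iso : ∀ a b → Induced (C (n + n)) (select ε) a b ⇔
                               Induced (C (n + n)) (select δ) (σ ⟨$⟩ʳ a) (σ ⟨$⟩ʳ b)) where

    π : Fin n → Fin n
    π u = σ ⟨$⟩ʳ u

    iso-⇒[] : ∀ b u v → (u , ε u) ⇒[ b ] (v , ε v) ⇔ (π u , δ (π u)) ⇒[ b ] (π v , δ (π v))
    iso-⇒[] false u v = ⇔.trans (⇔.sym (select-arc ε u v)) (⇔.trans (σ-iso u v) (select-arc δ (π u) (π v)))
    iso-⇒[] true  u v = iso-⇒[] false v u

    lift : Point → Point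
    lift (u , c) = π u , δ (π u) xor (ε u xor c)

    lift-auto : ∀ x y → x ⇒ y ⇔ lift x ⇒ lift y
    lift-auto (u , c) (v , d) = begin
      (u , c) ⇒ (v , d)                             ≡⟨ cong₂ (λ c′ d′ → (u , c′) ⇒ (v , d′))
                                                            (xor-cancelˡ (ε u) c) (xor-cancelˡ (ε v) d) ⟨
      (u , ε u xor s) ⇒ (v , ε v xor t)             ≈⟨ ⇒-xor u (ε u) v (ε v) s t ⟩
      (u , ε u) ⇒[ s xor t ] (v , ε v)              ≈⟨ iso-⇒[] (s xor t) u v ⟩
      (π u , δ (π u)) ⇒[ s xor t ] (π v , δ (π v))  ≈⟨ ⇒-xor (π u) (δ (π u)) (π v) (δ (π v)) s t ⟨
      lift (u , c) ⇒ lift (v , d)                   ∎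
      where
        open ⇔-Reasoning
        s = ε u xor c
        t = ε v xor d

    unlift : Point → Point
    unlift (v , d) = σ ⟨$⟩ˡ v , ε (σ ⟨$⟩ˡ v) xor (δ v xor d)

    lift∘unlift : ∀ y → lift (unlift y) ≡ y
    lift∘unlift (v , d) rewrite inverseʳ σ {v} | xor-cancelˡ (ε (σ ⟨$⟩ˡ v)) (δ v xor d) =
      cong (v ,_) (xor-cancelˡ (δ v) d)

    lift-rotation : Σ (Fin (n + n)) λ r → ∀ u → fold (u , ε u) next (toℕ r) ≡ (π u , δ (π u))
    lift-rotation = r , λ u → begin
      fold (u , ε u) next (toℕ r)        ≡⟨ lift≡fold (u , ε u) ⟨
      (π u , δ (π u) xor (ε u xor ε u))  ≡⟨ cong (λ b → π u , δ (π u) xor b) (Boolₚ.xor-same (ε u)) ⟩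
      (π u , δ (π u) xor false)          ≡⟨ cong (π u ,_) (Boolₚ.xor-identityʳ (δ (π u))) ⟩
      (π u , δ (π u))                    ∎
      where
        open ≡-Reasoning
        lift∘next : ∀ x → lift (next x) ≡ next (lift x)
        lift∘next = automorphism-commutes-with-next _≟ₚ_ {_⇒_} (λ {x} {y} → ⇒-asym {x} {y})
                      ⇒-next (λ {x} {w} → next-⇒ {x} {w}) lift∘unlift lift-auto
        r = proj₁ (commuting⇒fold next origin reach lift∘next)
        lift≡fold = proj₂ (commuting⇒fold next origin reach lift∘next)

  Hits : Fin (n + n) → Signs → Fin n → Set
  Hits r ε i = Σ (Fin n) λ u → fold (u , ε u) next (toℕ r) ≡ (i , true)

  hits? : ∀ r ε i → Dec (Hits r ε i)
  hits? r ε i = Finₚ.any? λ u → fold (u , ε u) next (toℕ r) ≟ₚ (i , true)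

  -- The selection ε turned by r steps around the circle.
  rotate : Fin (n + n) → Signs → Signs
  rotate r ε i = does (hits? r ε i)

  rotate-unique : ∀ {ε δ r} {π π⁻¹ : Fin n → Fin n} → (∀ i → π (π⁻¹ i) ≡ i) →
                  (∀ u → fold (u , ε u) next (toℕ r) ≡ (π u , δ (π u))) → δ ≗ rotate r ε
  rotate-unique {ε} {δ} {r} {π} {π⁻¹} π∘π⁻¹ moves i with δ i in δi
  ... | true  = sym (dec-true (hits? r ε i) (π⁻¹ i , (begin
    fold (π⁻¹ i , ε (π⁻¹ i)) next (toℕ r)  ≡⟨ moves (π⁻¹ i) ⟩
    (π (π⁻¹ i) , δ (π (π⁻¹ i)))            ≡⟨ cong (λ v → v , δ v) (π∘π⁻¹ i) ⟩
    (i , δ i)                              ≡⟨ cong (i ,_) δi ⟩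
    (i , true)                             ∎)))
    where open ≡-Reasoning
  ... | false = sym (dec-false (hits? r ε i) λ (u , hit) → true≢false (trans (sym (hit⇒δ≡true u hit)) δi))
    where
      hit⇒δ≡true : ∀ u → fold (u , ε u) next (toℕ r) ≡ (i , true) → δ i ≡ true
      hit⇒δ≡true u hit = let e = trans (sym (moves u)) hit in
        subst (λ v → δ v ≡ true) (cong proj₁ e) (cong proj₂ e)
      true≢false : true ≢ false
      true≢false ()

  Rotated : Rel Signs 0ℓ
  Rotated ε δ = Σ (Fin (n + n)) λ r → δ ≗ rotate r ε

  rotated? : Decidable Rotated
  rotated? ε δ = Finₚ.any? λ r → Finₚ.all? λ i → δ i Boolₚ.≟ rotate r ε i

  Rotated-refl : Reflexive Rotated
  Rotated-refl {ε} = zero , rotate-unique {ε} {ε} {zero} {λ u → u} (λ _ → refl) (λ _ → refl)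

  ≅ₛ⇒Rotated : ∀ {ε δ} → ε ≅ₛ δ → Rotated ε δ
  ≅ₛ⇒Rotated {ε} {δ} (σ , σ-iso) = r , rotate-unique {ε} {δ} {r} (λ _ → inverseʳ σ) moves
    where
      open Lift ε δ σ σ-iso
      r = proj₁ lift-rotation
      moves = proj₂ lift-rotation

  signs : Fin (2 ^ n) → Signs
  signs a = Inverse.to Finₚ.2↔Bool ∘ finToFun a

  signs-injective : ∀ {a b} → signs a ≗ signs b → a ≡ b
  signs-injective {a} {b} eq = finToFun-injective λ u → begin
    finToFun a u                           ≡⟨ Inverse.strictlyInverseʳ Finₚ.2↔Bool _ ⟨
    Inverse.from Finₚ.2↔Bool (signs a u)   ≡⟨ cong (Inverse.from Finₚ.2↔Bool) (eq u) ⟩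
    Inverse.from Finₚ.2↔Bool (signs b u)   ≡⟨ Inverse.strictlyInverseʳ Finₚ.2↔Bool _ ⟩
    finToFun b u                           ∎
    where open ≡-Reasoning

  open Representatives rotated? Rotated-refl

  classes : List Signs
  classes = representatives (List.map signs (allFin (2 ^ n)))

  class-count : ℕ
  class-count = List.length classes

  class : Fin class-count → Fin n → Fin (n + n)
  class j = select (List.lookup classes j)

  class-injective : ∀ j → Injective _≡_ _≡_ (class j)
  class-injective j = select-injective (List.lookup classes j)

  classes-non-isomorphic : ∀ i j → i ≢ j →
    ¬ (Induced (C (n + n)) (class i) ≅ Induced (C (n + n)) (class j))
  classes-non-isomorphic i j = representatives-distinct {S = _≅ₛ_}
    (λ {ε} {δ} → ≅-sym {T = Induced (C (n + n)) (select ε)} {U = Induced (C (n + n)) (select δ)})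
    (λ {ε} {δ} → ≅ₛ⇒Rotated {ε} {δ}) (List.map signs (allFin (2 ^ n)))

  2^n≤class-count*[n+n] : 2 ^ n ≤ class-count * (n + n)
  2^n≤class-count*[n+n] = Finₚ.injective⇒≤ {f = label} label-injective
    where
      covered : ∀ a → Any (λ ε → Rotated ε (signs a)) classes
      covered a = representatives-cover (∈-map⁺ signs (∈-allFin a))
      class-of : Fin (2 ^ n) → Fin class-count
      class-of a = Any.index (covered a)
      rotation-of : Fin (2 ^ n) → Fin (n + n)
      rotation-of a = proj₁ (lookup-index (covered a))
      signs≗ : ∀ a → signs a ≗ rotate (rotation-of a) (List.lookup classes (class-of a))
      signs≗ a = proj₂ (lookup-index (covered a))
      label : Fin (2 ^ n) → Fin (class-count * (n + n))
      label a = combine (class-of a) (rotation-of a)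
      label-injective : Injective _≡_ _≡_ label
      label-injective {a} {b} eq = signs-injective λ u → begin
        signs a u                                                    ≡⟨ signs≗ a u ⟩
        rotate (rotation-of a) (List.lookup classes (class-of a)) u
          ≡⟨ cong₂ (λ r j → rotate r (List.lookup classes j) u) r≡ j≡ ⟩
        rotate (rotation-of b) (List.lookup classes (class-of b)) u  ≡⟨ signs≗ b u ⟨
        signs b u                                                    ∎
        where
          open ≡-Reasoning
          j≡ = Finₚ.combine-injectiveˡ (class-of a) (rotation-of a) (class-of b) (rotation-of b) eq
          r≡ = Finₚ.combine-injectiveʳ (class-of a) (rotation-of a) (class-of b) (rotation-of b) eq

  2^[n-1]≤n*class-count : 2 ^ ℕ.suc k ≤ n * class-count
  2^[n-1]≤n*class-count =
    ℕₚ.*-cancelˡ-≤ 2 (subst (2 ^ n ≤_) (a*[b+b]≡2*[b*a] class-count n) 2^n≤class-count*[n+n])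
    where
      a*[b+b]≡2*[b*a] : ∀ a b → a * (b + b) ≡ 2 * (b * a)
      a*[b+b]≡2*[b*a] = solve-∀

lemma16 : (n : ℕ) → .{{_ : NonZero n}} →
  Σ ℕ λ k → (2 ^ (n ∸ 1) ≤ n * k) ×
    Σ (Fin k → Fin n → Fin (n + n)) λ S →
      (∀ i → Injective _≡_ _≡_ (S i)) ×
      (∀ i j → i ≢ j → ¬ (Induced (C (n + n)) (S i) ≅ Induced (C (n + n)) (S j)))
lemma16 (ℕ.suc ℕ.zero) =
  1 , ℕₚ.≤-refl , (λ _ u → u ↑ˡ 1) , (λ _ → Finₚ.↑ˡ-injective 1 _ _) ,
  λ { zero zero 0≢0 _ → 0≢0 refl }
lemma16 (ℕ.suc (ℕ.suc k)) =
  class-count , 2^[n-1]≤n*class-count , class , class-injective , classes-non-isomorphic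
  where open Circle k
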